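{- Let $G=([n],E)$ be a graph and let $2\le k\le\lfloor n/2\rfloor$. For every $k$-subset $\sigma\subseteq[n]$, \[ \sum_{u\in\sigma} d_{k-1}(\sigma\setminus\{u\})=(k-1)\,d_k(\sigma)+2|E_\sigma|. \]
   Context: For $0\le j\le n$, the $j$-th token graph $F_j(G)$ has vertex set the $j$-subsets of $[n]$, with $\{A,B\}$ an edge iff $|A\cap B|=j-1$ and the symmetric difference $A\triangle B\in E$. For a $j$-subset $\eta$, $d_j(\eta)$ denotes the degree of $\eta$ in $F_j(G)$. For a $k$-subset $\sigma$, $E_\sigma=\{e\in E: e\subset\sigma\}$. -}

module Defs where

open import Data.Nat using (ℕ; zero; suc; _∸_)
open import Data.Bool using (Bool; true; false)
open import Data.Fin using (Fin)
open import Data.Fin.Properties using (any?)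
open import Data.Fin.Subset using (Subset; Side; inside; outside; ⁅_⁆; _∪_; _∩_; _─_; ∣_∣; _∈_; _⊆_)
open import Data.Fin.Subset.Properties using (_∈?_; _⊆?_)
open import Data.Vec using (Vec; []; _∷_; zipWith)
open import Data.Vec.Properties using (≡-dec)
open import Data.List using (List; []; _∷_; _++_; map; filter; length; allFin)
open import Data.Nat.ListAction using (sum)
open import Data.Product using (Σ; _×_; _,_)
open import Relation.Binary.PropositionalEquality using (_≡_)
open import Relation.Nullary using (Dec; yes; no)
open import Relation.Nullary.Decidable using (_×-dec_)
import Data.Bool.Properties as BP
import Data.Nat.Properties as NP

record Graph (n : ℕ) : Set where
  field
    adj   : Fin n → Fin n → Bool
    sym   : ∀ x y → adj x y ≡ adj y x
    irref : ∀ x → adj x x ≡ false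
open Graph public

IsEdge : ∀ {n} → Graph n → Subset n → Set
IsEdge {n} G S = Σ (Fin n) λ x → Σ (Fin n) λ y → (adj G x y ≡ true) × (S ≡ ⁅ x ⁆ ∪ ⁅ y ⁆)

isEdge? : ∀ {n} (G : Graph n) (S : Subset n) → Dec (IsEdge G S)
isEdge? {n} G S = any? λ x → any? λ y → (adj G x y BP.≟ true) ×-dec ≡-dec BP._≟_ S (⁅ x ⁆ ∪ ⁅ y ⁆)

_△_ : ∀ {n} → Subset n → Subset n → Subset n
A △ B = (A ─ B) ∪ (B ─ A)

allSubsets : (n : ℕ) → List (Subset n)
allSubsets zero = [] ∷ []
allSubsets (suc n) = map (inside ∷_) (allSubsets n) ++ map (outside ∷_) (allSubsets n)

-- Adjacency in the j-th token graph F_j(G) (between j-subsets A, B):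
-- |A ∩ B| = j - 1 and A △ B ∈ E.
TokenAdj : ∀ {n} → Graph n → ℕ → Subset n → Subset n → Set
TokenAdj G j A B = (∣ A ∩ B ∣ ≡ j ∸ 1) × IsEdge G (A △ B)

tokenAdj? : ∀ {n} (G : Graph n) (j : ℕ) (A B : Subset n) → Dec (TokenAdj G j A B)
tokenAdj? G j A B = (∣ A ∩ B ∣ NP.≟ j ∸ 1) ×-dec isEdge? G (A △ B)

deg : ∀ {n} → Graph n → ℕ → Subset n → ℕ
deg {n} G j η =
  length (filter (λ A → (∣ A ∣ NP.≟ j) ×-dec tokenAdj? G j A η) (allSubsets n))

edgesIn : ∀ {n} → Graph n → Subset n → ℕ
edgesIn {n} G σ = length (filter (λ S → isEdge? G S ×-dec (S ⊆? σ)) (allSubsets n))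

_∖_ : ∀ {n} → Subset n → Fin n → Subset n
σ ∖ u = σ ─ ⁅ u ⁆

sumOver : ∀ {n} → Subset n → (Fin n → ℕ) → ℕ
sumOver {n} σ f = sum (map f (filter (_∈? σ) (allFin n)))

{-# OPTIONS --safe #-}
module Submission where

-- Everything is counted over ordered pairs (a , b) of adjacent vertices.  An edge is
-- hit by exactly two such pairs, so 2|E_σ| counts the adjacent pairs inside σ.
-- Reindexing subsets A by A △ η, the neighbours of a j-set η in F_j(G) are the sets
-- {a,b} △ η with a ~ b and exactly one of a, b in η, so d_j(η) counts the adjacent
-- pairs leaving η.  For u ∈ σ a pair leaves σ ∖ u iff a ∈ σ, a ≠ u and (b ∉ σ or b = u);
-- summing over u ∈ σ gives (k - 1)[a ∈ σ ∌ b] + [a, b ∈ σ].  No bound on k is needed.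

open import Data.Bool using (Bool; true; false; _∧_; _∨_; not)
import Data.Bool as Bool
open import Data.Bool.Properties using (∧-zeroʳ; ∧-identityʳ)
open import Data.Empty using (⊥-elim)
open import Data.Fin using (Fin; zero; suc)
open import Data.Fin.Subset using (Subset; inside; outside; ⊥; ⊤; ⁅_⁆; _∪_; _∩_; _─_; ∣_∣; _∈_; _⊆_)
open import Data.Fin.Subset.Properties
  using (_∈?_; _⊆?_; x∈⁅x⁆; x∈⁅y⁆⇒x≡y; x∈p∪q⁻; x∈p∪q⁺; ∪-comm; ∩-identityʳ; p─⊥≡p)
open import Data.List using ([]; _∷_; _++_; map; filter; length; tabulate; allFin)
import Data.List.Properties as List
open import Data.Nat using (ℕ; zero; suc; _+_; _*_; _∸_; _≤_; _/_)
open import Data.Nat.ListAction using (sum)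
open import Data.Nat.ListAction.Properties using (sum-++)
open import Data.Nat.Properties
  using (_≟_; +-*-semiring; *-commutativeSemigroup; +-comm; +-suc; +-identityʳ; *-zeroʳ; *-identityʳ; *-comm; *-distribˡ-+;
         +-cancelˡ-≡; *-cancelˡ-≡; m+n∸n≡m)
open import Data.Nat.Tactic.RingSolver using (solve-∀)
open import Data.Product using (_×_; _,_)
open import Data.Sum using (_⊎_; inj₁; inj₂)
open import Data.Vec using ([]; _∷_; lookup)
import Data.Vec.Properties as Vec
open import Function using (_∘_)
open import Relation.Binary.PropositionalEquality
open import Relation.Nullary using (Dec; yes; no; does; ¬_)
open import Relation.Nullary.Decidable using (_×-dec_; dec-true; dec-false)
open import Defs hiding (sym)

open import Algebra.Properties.CommutativeSemigroup *-commutativeSemigroup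
  using () renaming (x∙yz≈y∙xz to x*[y*z]≡y*[x*z]; x∙yz≈z∙xy to x*[y*z]≡z*[x*y])
open import Algebra.Properties.Semiring.Sum +-*-semiring
  using (sum-syntax; sum-cong-≗; sum-replicate-zero; ∑-distrib-+; ∑-comm; *-distribˡ-sum; *-distribʳ-sum)

𝟙 : Bool → ℕ
𝟙 true  = 1
𝟙 false = 0

𝟙-∧ : ∀ x y → 𝟙 (x ∧ y) ≡ 𝟙 x * 𝟙 y
𝟙-∧ true  y = sym (+-identityʳ (𝟙 y))
𝟙-∧ false y = refl

length-filter : ∀ {a p} {A : Set a} {P : A → Set p} (P? : ∀ x → Dec (P x)) xs →
                length (filter P? xs) ≡ sum (map (𝟙 ∘ does ∘ P?) xs)
length-filter P? []       = refl
length-filter P? (x ∷ xs) with does (P? x)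
... | true  = cong suc (length-filter P? xs)
... | false = length-filter P? xs

sum-map-filter : ∀ {a p} {A : Set a} {P : A → Set p} (P? : ∀ x → Dec (P x)) (f : A → ℕ) xs →
                 sum (map f (filter P? xs)) ≡ sum (map (λ x → 𝟙 (does (P? x)) * f x) xs)
sum-map-filter P? f []       = refl
sum-map-filter P? f (x ∷ xs) with does (P? x)
... | true  = cong₂ _+_ (sym (+-identityʳ (f x))) (sum-map-filter P? f xs)
... | false = sum-map-filter P? f xs

sum-map-tabulate : ∀ {a} {A : Set a} {n} (g : Fin n → A) (f : A → ℕ) →
                   sum (map f (tabulate g)) ≡ ∑[ i < n ] f (g i)
sum-map-tabulate {n = zero}  g f = refl
sum-map-tabulate {n = suc n} g f = cong (f (g zero) +_) (sum-map-tabulate (g ∘ suc) f)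

lookup-⊥ : ∀ {n} (i : Fin n) → lookup ⊥ i ≡ false
lookup-⊥ i = Vec.lookup-replicate i outside

lookup-⁅x⁆-comm : ∀ {n} (x y : Fin n) → lookup ⁅ x ⁆ y ≡ lookup ⁅ y ⁆ x
lookup-⁅x⁆-comm zero    zero    = refl
lookup-⁅x⁆-comm zero    (suc y) = lookup-⊥ y
lookup-⁅x⁆-comm (suc x) zero    = sym (lookup-⊥ x)
lookup-⁅x⁆-comm (suc x) (suc y) = lookup-⁅x⁆-comm x y

lookup-⁅x⁆⇒≡ : ∀ {n} {x i : Fin n} → lookup ⁅ x ⁆ i ≡ true → i ≡ x
lookup-⁅x⁆⇒≡ {x = x} {i} e = x∈⁅y⁆⇒x≡y x (Vec.lookup⇒[]= i ⁅ x ⁆ e)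

lookup-⁅x⁆-x : ∀ {n} (x : Fin n) → lookup ⁅ x ⁆ x ≡ true
lookup-⁅x⁆-x x = Vec.[]=⇒lookup (x∈⁅x⁆ x)

lookup-⁅x⁆-≢ : ∀ {n} {x i : Fin n} → i ≢ x → lookup ⁅ x ⁆ i ≡ false
lookup-⁅x⁆-≢ {x = x} {i} i≢x with lookup ⁅ x ⁆ i in e
... | true  = ⊥-elim (i≢x (lookup-⁅x⁆⇒≡ e))
... | false = refl

lookup-∈? : ∀ {n} (i : Fin n) (p : Subset n) → does (i ∈? p) ≡ lookup p i
lookup-∈? zero    (inside ∷ p)  = refl
lookup-∈? zero    (outside ∷ p) = refl
lookup-∈? (suc i) (x ∷ p)       = lookup-∈? i p

lookup-─ : ∀ {n} (p q : Subset n) i → lookup (p ─ q) i ≡ lookup p i ∧ not (lookup q i)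
lookup-─ (x ∷ p) (inside ∷ q)  zero    = sym (∧-zeroʳ x)
lookup-─ (x ∷ p) (outside ∷ q) zero    = sym (∧-identityʳ x)
lookup-─ (x ∷ p) (y ∷ q)       (suc i) = lookup-─ p q i

∈⁅x,y⁆⇒ : ∀ {n} {x y i : Fin n} → i ∈ ⁅ x ⁆ ∪ ⁅ y ⁆ → i ≡ x ⊎ i ≡ y
∈⁅x,y⁆⇒ {x = x} {y} i∈ with x∈p∪q⁻ ⁅ x ⁆ ⁅ y ⁆ i∈
... | inj₁ i∈x = inj₁ (x∈⁅y⁆⇒x≡y x i∈x)
... | inj₂ i∈y = inj₂ (x∈⁅y⁆⇒x≡y y i∈y)

⁅x,y⁆≡⁅a,b⁆⇒ : ∀ {n} {x y a b : Fin n} → a ≢ b → ⁅ x ⁆ ∪ ⁅ y ⁆ ≡ ⁅ a ⁆ ∪ ⁅ b ⁆ →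
               (a ≡ x × b ≡ y) ⊎ (a ≡ y × b ≡ x)
⁅x,y⁆≡⁅a,b⁆⇒ {a = a} {b} a≢b eq
  with ∈⁅x,y⁆⇒ (subst (a ∈_) (sym eq) (x∈p∪q⁺ (inj₁ (x∈⁅x⁆ a))))
     | ∈⁅x,y⁆⇒ (subst (b ∈_) (sym eq) (x∈p∪q⁺ (inj₂ (x∈⁅x⁆ b))))
... | inj₁ a≡x | inj₂ b≡y = inj₁ (a≡x , b≡y)
... | inj₂ a≡y | inj₁ b≡x = inj₂ (a≡y , b≡x)
... | inj₁ a≡x | inj₁ b≡x = ⊥-elim (a≢b (trans a≡x (sym b≡x)))
... | inj₂ a≡y | inj₂ b≡y = ⊥-elim (a≢b (trans a≡y (sym b≡y)))

∑-zero : ∀ n {f : Fin n → ℕ} → (∀ i → f i ≡ 0) → ∑[ i < n ] f i ≡ 0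
∑-zero n f≡0 = trans (sum-cong-≗ f≡0) (sum-replicate-zero n)

∑-δ : ∀ {n} (x : Fin n) (f : Fin n → ℕ) → ∑[ i < n ] (𝟙 (lookup ⁅ x ⁆ i) * f i) ≡ f x
∑-δ {suc n} zero    f = trans (cong (f zero + 0 +_) (∑-zero n (λ i → cong (λ b → 𝟙 b * f (suc i)) (lookup-⊥ i))))
                              (trans (+-identityʳ _) (+-identityʳ (f zero)))
∑-δ {suc n} (suc x) f = ∑-δ x (f ∘ suc)

infix 4 _≟ₛ_
_≟ₛ_ : ∀ {n} (p q : Subset n) → Dec (p ≡ q)
_≟ₛ_ = Vec.≡-dec Bool._≟_

∑ₛ : ∀ {n} → (Subset n → ℕ) → ℕ
∑ₛ {zero}  F = F []
∑ₛ {suc n} F = ∑ₛ (λ A → F (inside ∷ A)) + ∑ₛ (λ A → F (outside ∷ A))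

infixl 10 ∑ₛ
syntax ∑ₛ (λ A → x) = ∑ₛ[ A ] x

sum-map-allSubsets : ∀ n (F : Subset n → ℕ) → sum (map F (allSubsets n)) ≡ ∑ₛ F
sum-map-allSubsets zero    F = +-identityʳ (F [])
sum-map-allSubsets (suc n) F = begin
  sum (map F (map (inside ∷_) L ++ map (outside ∷_) L))
    ≡⟨ cong sum (List.map-++ F (map (inside ∷_) L) _) ⟩
  sum (map F (map (inside ∷_) L) ++ map F (map (outside ∷_) L))
    ≡⟨ sum-++ (map F (map (inside ∷_) L)) _ ⟩
  sum (map F (map (inside ∷_) L)) + sum (map F (map (outside ∷_) L))
    ≡⟨ cong₂ _+_ (cong sum (sym (List.map-∘ L))) (cong sum (sym (List.map-∘ L))) ⟩
  sum (map (λ A → F (inside ∷ A)) L) + sum (map (λ A → F (outside ∷ A)) L)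
    ≡⟨ cong₂ _+_ (sum-map-allSubsets n _) (sum-map-allSubsets n _) ⟩
  ∑ₛ F ∎
  where open ≡-Reasoning
        L = allSubsets n

∑ₛ-cong : ∀ {n} {F H : Subset n → ℕ} → (∀ A → F A ≡ H A) → ∑ₛ F ≡ ∑ₛ H
∑ₛ-cong {zero}  F≡H = F≡H []
∑ₛ-cong {suc n} F≡H = cong₂ _+_ (∑ₛ-cong (F≡H ∘ (inside ∷_))) (∑ₛ-cong (F≡H ∘ (outside ∷_)))

∑ₛ-zero : ∀ {n} {F : Subset n → ℕ} → (∀ A → F A ≡ 0) → ∑ₛ F ≡ 0
∑ₛ-zero {zero}  F≡0 = F≡0 []
∑ₛ-zero {suc n} F≡0 = cong₂ _+_ (∑ₛ-zero (F≡0 ∘ (inside ∷_))) (∑ₛ-zero (F≡0 ∘ (outside ∷_)))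

∑ₛ-δ : ∀ {n} (X : Subset n) (F : Subset n → ℕ) → ∑ₛ[ T ] (F T * 𝟙 (does (T ≟ₛ X))) ≡ F X
∑ₛ-δ []            F = *-identityʳ (F [])
∑ₛ-δ (inside ∷ X)  F = trans (cong₂ _+_ (∑ₛ-δ X (F ∘ (inside ∷_))) (∑ₛ-zero (λ T → *-zeroʳ (F (outside ∷ T)))))
                             (+-identityʳ (F (inside ∷ X)))
∑ₛ-δ (outside ∷ X) F = cong₂ _+_ (∑ₛ-zero (λ T → *-zeroʳ (F (inside ∷ T)))) (∑ₛ-δ X (F ∘ (outside ∷_)))

∑ₛ-*-distribˡ : ∀ {n} c (F : Subset n → ℕ) → c * ∑ₛ F ≡ ∑ₛ[ A ] (c * F A)
∑ₛ-*-distribˡ {zero}  c F = refl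
∑ₛ-*-distribˡ {suc n} c F = trans (*-distribˡ-+ c (∑ₛ (F ∘ (inside ∷_))) _)
                                  (cong₂ _+_ (∑ₛ-*-distribˡ c (F ∘ (inside ∷_))) (∑ₛ-*-distribˡ c (F ∘ (outside ∷_))))

∑ₛ-∑-comm : ∀ {n m} (f : Subset n → Fin m → ℕ) → ∑ₛ[ A ] ∑[ i < m ] f A i ≡ ∑[ i < m ] ∑ₛ[ A ] f A i
∑ₛ-∑-comm {zero}  f = refl
∑ₛ-∑-comm {suc n} f = trans (cong₂ _+_ (∑ₛ-∑-comm (f ∘ (inside ∷_))) (∑ₛ-∑-comm (f ∘ (outside ∷_))))
                            (sym (∑-distrib-+ (λ i → ∑ₛ[ A ] f (inside ∷ A) i) (λ i → ∑ₛ[ A ] f (outside ∷ A) i)))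

△-involutive : ∀ {n} (A η : Subset n) → (A △ η) △ η ≡ A
△-involutive []            []            = refl
△-involutive (inside ∷ A)  (inside ∷ η)  = cong (inside ∷_) (△-involutive A η)
△-involutive (inside ∷ A)  (outside ∷ η) = cong (inside ∷_) (△-involutive A η)
△-involutive (outside ∷ A) (inside ∷ η)  = cong (outside ∷_) (△-involutive A η)
△-involutive (outside ∷ A) (outside ∷ η) = cong (outside ∷_) (△-involutive A η)

∑ₛ-△ : ∀ {n} (η : Subset n) (F : Subset n → ℕ) → ∑ₛ[ A ] F (A △ η) ≡ ∑ₛ F
∑ₛ-△ []            F = refl
∑ₛ-△ (inside ∷ η)  F = trans (cong₂ _+_ (∑ₛ-△ η (F ∘ (outside ∷_))) (∑ₛ-△ η (F ∘ (inside ∷_))))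
                             (+-comm (∑ₛ (F ∘ (outside ∷_))) _)
∑ₛ-△ (outside ∷ η) F = cong₂ _+_ (∑ₛ-△ η (F ∘ (inside ∷_))) (∑ₛ-△ η (F ∘ (outside ∷_)))

∣p∣≡∑ : ∀ {n} (p : Subset n) → ∣ p ∣ ≡ ∑[ i < n ] 𝟙 (lookup p i)
∣p∣≡∑ []            = refl
∣p∣≡∑ (inside ∷ p)  = cong suc (∣p∣≡∑ p)
∣p∣≡∑ (outside ∷ p) = ∣p∣≡∑ p

∣p─⁅x⁆∣+𝟙[x∈p] : ∀ {n} (p : Subset n) x → ∣ p ─ ⁅ x ⁆ ∣ + 𝟙 (lookup p x) ≡ ∣ p ∣
∣p─⁅x⁆∣+𝟙[x∈p] (inside ∷ p)  zero    = trans (+-comm ∣ p ─ ⊥ ∣ 1) (cong (suc ∘ ∣_∣) (p─⊥≡p p))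
∣p─⁅x⁆∣+𝟙[x∈p] (outside ∷ p) zero    = trans (+-identityʳ ∣ p ─ ⊥ ∣) (cong ∣_∣ (p─⊥≡p p))
∣p─⁅x⁆∣+𝟙[x∈p] (inside ∷ p)  (suc x) = cong suc (∣p─⁅x⁆∣+𝟙[x∈p] p x)
∣p─⁅x⁆∣+𝟙[x∈p] (outside ∷ p) (suc x) = ∣p─⁅x⁆∣+𝟙[x∈p] p x

∣p─⁅x⁆∣≡∣p∣∸1 : ∀ {n} (p : Subset n) {x} → lookup p x ≡ true → ∣ p ─ ⁅ x ⁆ ∣ ≡ ∣ p ∣ ∸ 1
∣p─⁅x⁆∣≡∣p∣∸1 p {x} x∈p = trans (sym (m+n∸n≡m ∣ p ─ ⁅ x ⁆ ∣ 1))
  (cong (_∸ 1) (trans (cong (λ e → ∣ p ─ ⁅ x ⁆ ∣ + 𝟙 e) (sym x∈p)) (∣p─⁅x⁆∣+𝟙[x∈p] p x)))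

∣p△q∣+2∣p∩q∣ : ∀ {n} (p q : Subset n) → ∣ p △ q ∣ + 2 * ∣ p ∩ q ∣ ≡ ∣ p ∣ + ∣ q ∣
∣p△q∣+2∣p∩q∣ []            []            = refl
∣p△q∣+2∣p∩q∣ (inside ∷ p)  (inside ∷ q)  = begin
  ∣ p △ q ∣ + 2 * suc ∣ p ∩ q ∣   ≡⟨ move-2 ∣ p △ q ∣ ∣ p ∩ q ∣ ⟩
  2 + (∣ p △ q ∣ + 2 * ∣ p ∩ q ∣) ≡⟨ cong (2 +_) (∣p△q∣+2∣p∩q∣ p q) ⟩
  2 + (∣ p ∣ + ∣ q ∣)             ≡⟨ cong suc (sym (+-suc ∣ p ∣ ∣ q ∣)) ⟩
  suc ∣ p ∣ + suc ∣ q ∣           ∎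
  where open ≡-Reasoning
        move-2 : ∀ r s → r + 2 * suc s ≡ 2 + (r + 2 * s)
        move-2 = solve-∀
∣p△q∣+2∣p∩q∣ (inside ∷ p)  (outside ∷ q) = cong suc (∣p△q∣+2∣p∩q∣ p q)
∣p△q∣+2∣p∩q∣ (outside ∷ p) (inside ∷ q)  = trans (cong suc (∣p△q∣+2∣p∩q∣ p q)) (sym (+-suc ∣ p ∣ ∣ q ∣))
∣p△q∣+2∣p∩q∣ (outside ∷ p) (outside ∷ q) = ∣p△q∣+2∣p∩q∣ p q

∣[p△q]∩q∣+∣p∩q∣ : ∀ {n} (p q : Subset n) → ∣ (p △ q) ∩ q ∣ + ∣ p ∩ q ∣ ≡ ∣ q ∣
∣[p△q]∩q∣+∣p∩q∣ []            []            = refl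
∣[p△q]∩q∣+∣p∩q∣ (inside ∷ p)  (inside ∷ q)  = trans (+-suc _ _) (cong suc (∣[p△q]∩q∣+∣p∩q∣ p q))
∣[p△q]∩q∣+∣p∩q∣ (inside ∷ p)  (outside ∷ q) = ∣[p△q]∩q∣+∣p∩q∣ p q
∣[p△q]∩q∣+∣p∩q∣ (outside ∷ p) (inside ∷ q)  = cong suc (∣[p△q]∩q∣+∣p∩q∣ p q)
∣[p△q]∩q∣+∣p∩q∣ (outside ∷ p) (outside ∷ q) = ∣[p△q]∩q∣+∣p∩q∣ p q

𝟙-∨-∧ : ∀ x y z → ¬ (x ≡ true × y ≡ true) → 𝟙 ((x ∨ y) ∧ z) ≡ 𝟙 x * 𝟙 z + 𝟙 y * 𝟙 z
𝟙-∨-∧ true  true  z     both = ⊥-elim (both (refl , refl))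
𝟙-∨-∧ true  false true  _    = refl
𝟙-∨-∧ true  false false _    = refl
𝟙-∨-∧ false y     z     _    = 𝟙-∧ y z

∣⁅a,b⁆∩p∣ : ∀ {n} {a b : Fin n} → a ≢ b → (p : Subset n) →
            ∣ (⁅ a ⁆ ∪ ⁅ b ⁆) ∩ p ∣ ≡ 𝟙 (lookup p a) + 𝟙 (lookup p b)
∣⁅a,b⁆∩p∣ {n} {a} {b} a≢b p = begin
  ∣ (⁅ a ⁆ ∪ ⁅ b ⁆) ∩ p ∣
    ≡⟨ ∣p∣≡∑ ((⁅ a ⁆ ∪ ⁅ b ⁆) ∩ p) ⟩
  ∑[ i < n ] 𝟙 (lookup ((⁅ a ⁆ ∪ ⁅ b ⁆) ∩ p) i)
    ≡⟨ sum-cong-≗ pointwise ⟩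
  ∑[ i < n ] (𝟙 (lookup ⁅ a ⁆ i) * 𝟙 (lookup p i) + 𝟙 (lookup ⁅ b ⁆ i) * 𝟙 (lookup p i))
    ≡⟨ ∑-distrib-+ (λ i → 𝟙 (lookup ⁅ a ⁆ i) * 𝟙 (lookup p i)) (λ i → 𝟙 (lookup ⁅ b ⁆ i) * 𝟙 (lookup p i)) ⟩
  ∑[ i < n ] (𝟙 (lookup ⁅ a ⁆ i) * 𝟙 (lookup p i)) + ∑[ i < n ] (𝟙 (lookup ⁅ b ⁆ i) * 𝟙 (lookup p i))
    ≡⟨ cong₂ _+_ (∑-δ a (𝟙 ∘ lookup p)) (∑-δ b (𝟙 ∘ lookup p)) ⟩
  𝟙 (lookup p a) + 𝟙 (lookup p b) ∎
  where
    open ≡-Reasoning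
    pointwise : ∀ i → 𝟙 (lookup ((⁅ a ⁆ ∪ ⁅ b ⁆) ∩ p) i)
                    ≡ 𝟙 (lookup ⁅ a ⁆ i) * 𝟙 (lookup p i) + 𝟙 (lookup ⁅ b ⁆ i) * 𝟙 (lookup p i)
    pointwise i = begin
      𝟙 (lookup ((⁅ a ⁆ ∪ ⁅ b ⁆) ∩ p) i)
        ≡⟨ cong 𝟙 (trans (Vec.lookup-zipWith _∧_ i (⁅ a ⁆ ∪ ⁅ b ⁆) p)
                         (cong (_∧ lookup p i) (Vec.lookup-zipWith _∨_ i ⁅ a ⁆ ⁅ b ⁆))) ⟩
      𝟙 ((lookup ⁅ a ⁆ i ∨ lookup ⁅ b ⁆ i) ∧ lookup p i)
        ≡⟨ 𝟙-∨-∧ _ _ _ (λ (i∈a , i∈b) → a≢b (trans (sym (lookup-⁅x⁆⇒≡ i∈a)) (lookup-⁅x⁆⇒≡ i∈b))) ⟩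
      𝟙 (lookup ⁅ a ⁆ i) * 𝟙 (lookup p i) + 𝟙 (lookup ⁅ b ⁆ i) * 𝟙 (lookup p i) ∎

∣⁅a,b⁆∣ : ∀ {n} {a b : Fin n} → a ≢ b → ∣ ⁅ a ⁆ ∪ ⁅ b ⁆ ∣ ≡ 2
∣⁅a,b⁆∣ {n} {a} {b} a≢b = begin
  ∣ ⁅ a ⁆ ∪ ⁅ b ⁆ ∣           ≡⟨ cong ∣_∣ (sym (∩-identityʳ (⁅ a ⁆ ∪ ⁅ b ⁆))) ⟩
  ∣ (⁅ a ⁆ ∪ ⁅ b ⁆) ∩ ⊤ ∣     ≡⟨ ∣⁅a,b⁆∩p∣ a≢b ⊤ ⟩
  𝟙 (lookup ⊤ a) + 𝟙 (lookup ⊤ b) ≡⟨ cong₂ (λ x y → 𝟙 x + 𝟙 y) (Vec.lookup-replicate a inside) (Vec.lookup-replicate b inside) ⟩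
  2 ∎
  where open ≡-Reasoning

𝟙[⁅a,b⁆⊆p] : ∀ {n} (a b : Fin n) (p : Subset n) → 𝟙 (does (⁅ a ⁆ ∪ ⁅ b ⁆ ⊆? p)) ≡ 𝟙 (lookup p a) * 𝟙 (lookup p b)
𝟙[⁅a,b⁆⊆p] a b p with ⁅ a ⁆ ∪ ⁅ b ⁆ ⊆? p
... | yes ab⊆p = sym (cong₂ (λ u v → 𝟙 u * 𝟙 v) (Vec.[]=⇒lookup (ab⊆p (x∈p∪q⁺ (inj₁ (x∈⁅x⁆ a)))))
                                                 (Vec.[]=⇒lookup (ab⊆p (x∈p∪q⁺ (inj₂ (x∈⁅x⁆ b))))))
... | no ab⊈p with lookup p a in a∈p | lookup p b in b∈p
...   | false | _     = refl
...   | true  | false = refl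
...   | true  | true  = ⊥-elim (ab⊈p ab⊆p)
  where
    ab⊆p : ⁅ a ⁆ ∪ ⁅ b ⁆ ⊆ p
    ab⊆p i∈ab with ∈⁅x,y⁆⇒ i∈ab
    ... | inj₁ refl = Vec.lookup⇒[]= a p a∈p
    ... | inj₂ refl = Vec.lookup⇒[]= b p b∈p

𝟙[⁅x,y⁆≡⁅a,b⁆] : ∀ {n} {x y a b : Fin n} → x ≢ y → a ≢ b →
                 𝟙 (does (⁅ x ⁆ ∪ ⁅ y ⁆ ≟ₛ ⁅ a ⁆ ∪ ⁅ b ⁆))
                   ≡ 𝟙 (lookup ⁅ x ⁆ a) * 𝟙 (lookup ⁅ y ⁆ b) + 𝟙 (lookup ⁅ y ⁆ a) * 𝟙 (lookup ⁅ x ⁆ b)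
𝟙[⁅x,y⁆≡⁅a,b⁆] {x = x} {y} {a} {b} x≢y a≢b with ⁅ x ⁆ ∪ ⁅ y ⁆ ≟ₛ ⁅ a ⁆ ∪ ⁅ b ⁆
... | yes eq with ⁅x,y⁆≡⁅a,b⁆⇒ a≢b eq
...   | inj₁ (refl , refl) = sym (cong₂ _+_ (cong₂ (λ u v → 𝟙 u * 𝟙 v) (lookup-⁅x⁆-x x) (lookup-⁅x⁆-x y))
                                          (cong (λ u → 𝟙 u * 𝟙 (lookup ⁅ x ⁆ y)) (lookup-⁅x⁆-≢ x≢y)))
...   | inj₂ (refl , refl) = sym (cong₂ _+_ (cong (λ u → 𝟙 u * 𝟙 (lookup ⁅ y ⁆ x)) (lookup-⁅x⁆-≢ (x≢y ∘ sym)))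
                                          (cong₂ (λ u v → 𝟙 u * 𝟙 v) (lookup-⁅x⁆-x y) (lookup-⁅x⁆-x x)))
𝟙[⁅x,y⁆≡⁅a,b⁆] {x = x} {y} {a} {b} x≢y a≢b | no neq
  with lookup ⁅ x ⁆ a in xa | lookup ⁅ y ⁆ b in yb | lookup ⁅ y ⁆ a in ya | lookup ⁅ x ⁆ b in xb
... | true  | true  | _     | _     = ⊥-elim (neq (cong₂ (λ u v → ⁅ u ⁆ ∪ ⁅ v ⁆) (sym (lookup-⁅x⁆⇒≡ xa)) (sym (lookup-⁅x⁆⇒≡ yb))))
... | _     | _     | true  | true  = ⊥-elim (neq (trans (∪-comm ⁅ x ⁆ ⁅ y ⁆)
                                                     (cong₂ (λ u v → ⁅ u ⁆ ∪ ⁅ v ⁆) (sym (lookup-⁅x⁆⇒≡ ya)) (sym (lookup-⁅x⁆⇒≡ xb)))))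
... | false | _     | false | _     = refl
... | false | _     | true  | false = refl
... | true  | false | false | _     = refl
... | true  | false | true  | false = refl

crossing : ∀ {n} → Subset n → Fin n → Fin n → ℕ
crossing η a b = 𝟙 (lookup η a) * 𝟙 (not (lookup η b))

𝟙[s≡j]*𝟙[t≡j∸1] : ∀ {s t j m} → s + 2 * m ≡ 2 + j → t + m ≡ j →
                  𝟙 (does (s ≟ j)) * 𝟙 (does (t ≟ j ∸ 1)) ≡ 𝟙 (does (m ≟ 1))
𝟙[s≡j]*𝟙[t≡j∸1] {s} {t} {j} {m} size meet with m ≟ 1
... | yes refl = cong₂ (λ u v → 𝟙 u * 𝟙 v) (dec-true (s ≟ j) (+-cancelˡ-≡ 2 s j (trans (+-comm 2 s) size)))
                                           (dec-true (t ≟ j ∸ 1) (trans (sym (m+n∸n≡m t 1)) (cong (_∸ 1) meet)))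
... | no m≢1   = trans (cong (λ u → 𝟙 u * 𝟙 (does (t ≟ j ∸ 1))) (dec-false (s ≟ j) s≢j))
                       (cong 𝟙 (sym (dec-false (m ≟ 1) m≢1)))
  where
    s≢j : s ≢ j
    s≢j refl = m≢1 (*-cancelˡ-≡ m 1 2 (+-cancelˡ-≡ s (2 * m) 2 (trans size (+-comm 2 s))))

𝟙[𝟙x+𝟙y≡1] : ∀ x y → 𝟙 (does (𝟙 x + 𝟙 y ≟ 1)) ≡ 𝟙 x * 𝟙 (not y) + 𝟙 y * 𝟙 (not x)
𝟙[𝟙x+𝟙y≡1] true  true  = refl
𝟙[𝟙x+𝟙y≡1] true  false = refl
𝟙[𝟙x+𝟙y≡1] false true  = refl
𝟙[𝟙x+𝟙y≡1] false false = refl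

𝟙[exchange] : ∀ {n j} {a b : Fin n} (η : Subset n) → a ≢ b → ∣ η ∣ ≡ j →
              𝟙 (does (∣ (⁅ a ⁆ ∪ ⁅ b ⁆) △ η ∣ ≟ j)) * 𝟙 (does (∣ ((⁅ a ⁆ ∪ ⁅ b ⁆) △ η) ∩ η ∣ ≟ j ∸ 1))
                ≡ crossing η a b + crossing η b a
𝟙[exchange] {j = j} {a} {b} η a≢b ∣η∣≡j =
  trans (𝟙[s≡j]*𝟙[t≡j∸1] {∣ D △ η ∣} {∣ (D △ η) ∩ η ∣} size meet) (𝟙[𝟙x+𝟙y≡1] (lookup η a) (lookup η b))
  where
    D = ⁅ a ⁆ ∪ ⁅ b ⁆
    ∣D∩η∣ = ∣⁅a,b⁆∩p∣ a≢b η
    size : ∣ D △ η ∣ + 2 * (𝟙 (lookup η a) + 𝟙 (lookup η b)) ≡ 2 + j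
    size = trans (cong (λ m → ∣ D △ η ∣ + 2 * m) (sym ∣D∩η∣))
                 (trans (∣p△q∣+2∣p∩q∣ D η) (cong₂ _+_ (∣⁅a,b⁆∣ a≢b) ∣η∣≡j))
    meet : ∣ (D △ η) ∩ η ∣ + (𝟙 (lookup η a) + 𝟙 (lookup η b)) ≡ j
    meet = trans (cong (∣ (D △ η) ∩ η ∣ +_) (sym ∣D∩η∣)) (trans (∣[p△q]∩q∣+∣p∩q∣ D η) ∣η∣≡j)

-- s, sa, sb: whether u, a, b lie in σ; ea, eb: whether u = a, u = b.
𝟙-remove : ∀ s sa sb ea eb → (eb ≡ true → s ≡ sb) → ¬ (ea ≡ true × eb ≡ true) →
           𝟙 s * (𝟙 (sa ∧ not ea) * 𝟙 (not (sb ∧ not eb)))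
             ≡ 𝟙 (s ∧ not ea) * (𝟙 sa * 𝟙 (not sb)) + 𝟙 eb * (𝟙 sa * 𝟙 sb)
𝟙-remove s sa sb true  true  _     excl = ⊥-elim (excl (refl , refl))
𝟙-remove s sa sb true  false _     _
  rewrite ∧-zeroʳ sa | ∧-zeroʳ s = *-zeroʳ (𝟙 s)
𝟙-remove s sa sb false false _     _
  rewrite ∧-identityʳ sa | ∧-identityʳ sb | ∧-identityʳ s = sym (+-identityʳ _)
𝟙-remove true  _     false false true  s≡sb _ with () ← s≡sb refl
𝟙-remove false _     true  false true  s≡sb _ with () ← s≡sb refl
𝟙-remove true  true  true  false true  _    _ = refl
𝟙-remove true  false true  false true  _    _ = refl
𝟙-remove false true  false false true  _    _ = refl
𝟙-remove false false false false true  _    _ = refl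

∑-remove : ∀ {n} (σ : Subset n) {a b : Fin n} → a ≢ b →
           ∑[ u < n ] (𝟙 (lookup σ u) * crossing (σ ∖ u) a b)
             ≡ (∣ σ ∣ ∸ 1) * crossing σ a b + 𝟙 (lookup σ a) * 𝟙 (lookup σ b)
∑-remove {n} σ {a} {b} a≢b = begin
  ∑[ u < n ] (𝟙 (lookup σ u) * crossing (σ ∖ u) a b)
    ≡⟨ sum-cong-≗ pointwise ⟩
  ∑[ u < n ] (𝟙 (lookup (σ ─ ⁅ a ⁆) u) * c₁ + 𝟙 (lookup ⁅ b ⁆ u) * c₂)
    ≡⟨ ∑-distrib-+ (λ u → 𝟙 (lookup (σ ─ ⁅ a ⁆) u) * c₁) (λ u → 𝟙 (lookup ⁅ b ⁆ u) * c₂) ⟩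
  ∑[ u < n ] (𝟙 (lookup (σ ─ ⁅ a ⁆) u) * c₁) + ∑[ u < n ] (𝟙 (lookup ⁅ b ⁆ u) * c₂)
    ≡⟨ cong₂ _+_ (trans (sym (*-distribʳ-sum c₁ (𝟙 ∘ lookup (σ ─ ⁅ a ⁆)))) (cong (_* c₁) (sym (∣p∣≡∑ (σ ─ ⁅ a ⁆)))))
                 (∑-δ b (λ _ → c₂)) ⟩
  ∣ σ ─ ⁅ a ⁆ ∣ * c₁ + c₂
    ≡⟨ cong (_+ c₂) count ⟩
  (∣ σ ∣ ∸ 1) * c₁ + c₂ ∎
  where
    open ≡-Reasoning
    c₁ = crossing σ a b
    c₂ = 𝟙 (lookup σ a) * 𝟙 (lookup σ b)
    pointwise : ∀ u → 𝟙 (lookup σ u) * crossing (σ ∖ u) a b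
                      ≡ 𝟙 (lookup (σ ─ ⁅ a ⁆) u) * c₁ + 𝟙 (lookup ⁅ b ⁆ u) * c₂
    pointwise u
      rewrite lookup-─ σ ⁅ u ⁆ a | lookup-─ σ ⁅ u ⁆ b | lookup-─ σ ⁅ a ⁆ u
            | lookup-⁅x⁆-comm u a | lookup-⁅x⁆-comm u b
      = 𝟙-remove (lookup σ u) (lookup σ a) (lookup σ b) (lookup ⁅ a ⁆ u) (lookup ⁅ b ⁆ u)
                 (λ u∈b → cong (lookup σ) (lookup-⁅x⁆⇒≡ u∈b))
                 (λ (u∈a , u∈b) → a≢b (trans (sym (lookup-⁅x⁆⇒≡ u∈a)) (lookup-⁅x⁆⇒≡ u∈b)))
    count : ∣ σ ─ ⁅ a ⁆ ∣ * c₁ ≡ (∣ σ ∣ ∸ 1) * c₁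
    count with lookup σ a in a∈σ
    ... | true  = cong (_* (1 * 𝟙 (not (lookup σ b)))) (∣p─⁅x⁆∣≡∣p∣∸1 σ a∈σ)
    ... | false = trans (*-zeroʳ ∣ σ ─ ⁅ a ⁆ ∣) (sym (*-zeroʳ (∣ σ ∣ ∸ 1)))

module _ {n : ℕ} (G : Graph n) where

  adj⇒≢ : ∀ {a b} → adj G a b ≡ true → a ≢ b
  adj⇒≢ {a} a~a refl with () ← trans (sym a~a) (irref G a)

  ∑adj : (Fin n → Fin n → ℕ) → ℕ
  ∑adj f = ∑[ a < n ] ∑[ b < n ] (𝟙 (adj G a b) * f a b)

  ∑adj-cong : ∀ {f g : Fin n → Fin n → ℕ} → (∀ {a b} → adj G a b ≡ true → f a b ≡ g a b) → ∑adj f ≡ ∑adj g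
  ∑adj-cong {f} {g} f≡g = sum-cong-≗ λ a → sum-cong-≗ λ b → pointwise a b
    where
      pointwise : ∀ a b → 𝟙 (adj G a b) * f a b ≡ 𝟙 (adj G a b) * g a b
      pointwise a b with adj G a b in a~b
      ... | true  = cong (1 *_) (f≡g a~b)
      ... | false = refl

  ∑adj-+ : ∀ f g → ∑adj (λ a b → f a b + g a b) ≡ ∑adj f + ∑adj g
  ∑adj-+ f g = trans (sum-cong-≗ λ a → trans (sum-cong-≗ λ b → *-distribˡ-+ (𝟙 (adj G a b)) (f a b) (g a b))
                                            (∑-distrib-+ (λ b → 𝟙 (adj G a b) * f a b) (λ b → 𝟙 (adj G a b) * g a b)))
                     (∑-distrib-+ (λ a → ∑[ b < n ] (𝟙 (adj G a b) * f a b)) (λ a → ∑[ b < n ] (𝟙 (adj G a b) * g a b)))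

  ∑adj-*-distribˡ : ∀ c f → c * ∑adj f ≡ ∑adj (λ a b → c * f a b)
  ∑adj-*-distribˡ c f =
    trans (*-distribˡ-sum c (λ a → ∑[ b < n ] (𝟙 (adj G a b) * f a b)))
          (sum-cong-≗ λ a → trans (*-distribˡ-sum c (λ b → 𝟙 (adj G a b) * f a b))
                                  (sum-cong-≗ λ b → x*[y*z]≡y*[x*z] c (𝟙 (adj G a b)) (f a b)))

  ∑adj-flip : ∀ f → ∑adj (λ a b → f b a) ≡ ∑adj f
  ∑adj-flip f = trans (∑-comm (λ a b → 𝟙 (adj G a b) * f b a))
                      (sum-cong-≗ λ b → sum-cong-≗ λ a → cong (λ e → 𝟙 e * f b a) (Graph.sym G a b))

  ∑-∑adj-comm : ∀ {m} (f : Fin m → Fin n → Fin n → ℕ) →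
                ∑[ u < m ] ∑adj (f u) ≡ ∑adj (λ a b → ∑[ u < m ] f u a b)
  ∑-∑adj-comm {m} f = begin
    ∑[ u < m ] ∑[ a < n ] ∑[ b < n ] (𝟙 (adj G a b) * f u a b)
      ≡⟨ ∑-comm (λ u a → ∑[ b < n ] (𝟙 (adj G a b) * f u a b)) ⟩
    ∑[ a < n ] ∑[ u < m ] ∑[ b < n ] (𝟙 (adj G a b) * f u a b)
      ≡⟨ sum-cong-≗ (λ a → ∑-comm (λ u b → 𝟙 (adj G a b) * f u a b)) ⟩
    ∑[ a < n ] ∑[ b < n ] ∑[ u < m ] (𝟙 (adj G a b) * f u a b)
      ≡⟨ sum-cong-≗ (λ a → sum-cong-≗ λ b → sym (*-distribˡ-sum (𝟙 (adj G a b)) (λ u → f u a b))) ⟩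
    ∑adj (λ a b → ∑[ u < m ] f u a b) ∎
    where open ≡-Reasoning

  ∑ₛ-∑adj-comm : ∀ (f : Subset n → Fin n → Fin n → ℕ) →
                 ∑ₛ[ T ] ∑adj (f T) ≡ ∑adj (λ a b → ∑ₛ[ T ] f T a b)
  ∑ₛ-∑adj-comm f = begin
    ∑ₛ[ T ] ∑[ a < n ] ∑[ b < n ] (𝟙 (adj G a b) * f T a b)
      ≡⟨ ∑ₛ-∑-comm (λ T a → ∑[ b < n ] (𝟙 (adj G a b) * f T a b)) ⟩
    ∑[ a < n ] ∑ₛ[ T ] ∑[ b < n ] (𝟙 (adj G a b) * f T a b)
      ≡⟨ sum-cong-≗ (λ a → ∑ₛ-∑-comm (λ T b → 𝟙 (adj G a b) * f T a b)) ⟩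
    ∑[ a < n ] ∑[ b < n ] ∑ₛ[ T ] (𝟙 (adj G a b) * f T a b)
      ≡⟨ sum-cong-≗ (λ a → sum-cong-≗ λ b → sym (∑ₛ-*-distribˡ (𝟙 (adj G a b)) (λ T → f T a b))) ⟩
    ∑adj (λ a b → ∑ₛ[ T ] f T a b) ∎
    where open ≡-Reasoning

  ∑adj-δ : ∀ x y → ∑adj (λ a b → 𝟙 (lookup ⁅ x ⁆ a) * 𝟙 (lookup ⁅ y ⁆ b)) ≡ 𝟙 (adj G x y)
  ∑adj-δ x y = begin
    ∑[ a < n ] ∑[ b < n ] (𝟙 (adj G a b) * (𝟙 (lookup ⁅ x ⁆ a) * 𝟙 (lookup ⁅ y ⁆ b)))
      ≡⟨ sum-cong-≗ (λ a → sum-cong-≗ λ b → x*[y*z]≡y*[x*z] (𝟙 (adj G a b)) (𝟙 (lookup ⁅ x ⁆ a)) _) ⟩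
    ∑[ a < n ] ∑[ b < n ] (𝟙 (lookup ⁅ x ⁆ a) * (𝟙 (adj G a b) * 𝟙 (lookup ⁅ y ⁆ b)))
      ≡⟨ sum-cong-≗ (λ a → sym (*-distribˡ-sum (𝟙 (lookup ⁅ x ⁆ a)) (λ b → 𝟙 (adj G a b) * 𝟙 (lookup ⁅ y ⁆ b)))) ⟩
    ∑[ a < n ] (𝟙 (lookup ⁅ x ⁆ a) * ∑[ b < n ] (𝟙 (adj G a b) * 𝟙 (lookup ⁅ y ⁆ b)))
      ≡⟨ sum-cong-≗ (λ a → cong (𝟙 (lookup ⁅ x ⁆ a) *_)
                                 (trans (sum-cong-≗ λ b → *-comm (𝟙 (adj G a b)) _) (∑-δ y (𝟙 ∘ adj G a)))) ⟩
    ∑[ a < n ] (𝟙 (lookup ⁅ x ⁆ a) * 𝟙 (adj G a y))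
      ≡⟨ ∑-δ x (λ a → 𝟙 (adj G a y)) ⟩
    𝟙 (adj G x y) ∎
    where open ≡-Reasoning

  ∑adj-zero : ∀ {f : Fin n → Fin n → ℕ} → (∀ {a b} → adj G a b ≡ true → f a b ≡ 0) → ∑adj f ≡ 0
  ∑adj-zero f≡0 = trans (∑adj-cong f≡0) (∑-zero n λ a → ∑-zero n λ b → *-zeroʳ (𝟙 (adj G a b)))

  2*𝟙[isEdge] : ∀ T → 2 * 𝟙 (does (isEdge? G T)) ≡ ∑adj (λ a b → 𝟙 (does (T ≟ₛ ⁅ a ⁆ ∪ ⁅ b ⁆)))
  2*𝟙[isEdge] T with isEdge? G T
  ... | yes (x , y , x~y , refl) = begin
    2                                     ≡⟨ cong₂ (λ u v → 𝟙 u + 𝟙 v) (sym x~y) (trans (sym x~y) (Graph.sym G x y)) ⟩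
    𝟙 (adj G x y) + 𝟙 (adj G y x)         ≡⟨ sym (cong₂ _+_ (∑adj-δ x y) (∑adj-δ y x)) ⟩
    ∑adj (λ a b → 𝟙 (lookup ⁅ x ⁆ a) * 𝟙 (lookup ⁅ y ⁆ b)) + ∑adj (λ a b → 𝟙 (lookup ⁅ y ⁆ a) * 𝟙 (lookup ⁅ x ⁆ b))
                                          ≡⟨ sym (∑adj-+ _ _) ⟩
    ∑adj (λ a b → 𝟙 (lookup ⁅ x ⁆ a) * 𝟙 (lookup ⁅ y ⁆ b) + 𝟙 (lookup ⁅ y ⁆ a) * 𝟙 (lookup ⁅ x ⁆ b))
                                          ≡⟨ ∑adj-cong (λ a~b → sym (𝟙[⁅x,y⁆≡⁅a,b⁆] (adj⇒≢ x~y) (adj⇒≢ a~b))) ⟩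
    ∑adj (λ a b → 𝟙 (does (⁅ x ⁆ ∪ ⁅ y ⁆ ≟ₛ ⁅ a ⁆ ∪ ⁅ b ⁆))) ∎
    where open ≡-Reasoning
  ... | no T∉E = sym (∑adj-zero T≢⁅a,b⁆)
    where
      T≢⁅a,b⁆ : ∀ {a b} → adj G a b ≡ true → 𝟙 (does (T ≟ₛ ⁅ a ⁆ ∪ ⁅ b ⁆)) ≡ 0
      T≢⁅a,b⁆ {a} {b} a~b with T ≟ₛ ⁅ a ⁆ ∪ ⁅ b ⁆
      ... | yes T≡ab = ⊥-elim (T∉E (a , b , a~b , T≡ab))
      ... | no  _    = refl

  2*∑ₛ-isEdge : ∀ (F : Subset n → ℕ) →
                2 * ∑ₛ[ T ] (𝟙 (does (isEdge? G T)) * F T) ≡ ∑adj (λ a b → F (⁅ a ⁆ ∪ ⁅ b ⁆))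
  2*∑ₛ-isEdge F = begin
    2 * ∑ₛ[ T ] (𝟙 (does (isEdge? G T)) * F T)
      ≡⟨ ∑ₛ-*-distribˡ 2 (λ T → 𝟙 (does (isEdge? G T)) * F T) ⟩
    ∑ₛ[ T ] (2 * (𝟙 (does (isEdge? G T)) * F T))
      ≡⟨ ∑ₛ-cong (λ T → trans (reorder (𝟙 (does (isEdge? G T))) (F T)) (cong (F T *_) (2*𝟙[isEdge] T))) ⟩
    ∑ₛ[ T ] (F T * ∑adj (λ a b → 𝟙 (does (T ≟ₛ ⁅ a ⁆ ∪ ⁅ b ⁆))))
      ≡⟨ ∑ₛ-cong (λ T → ∑adj-*-distribˡ (F T) _) ⟩
    ∑ₛ[ T ] ∑adj (λ a b → F T * 𝟙 (does (T ≟ₛ ⁅ a ⁆ ∪ ⁅ b ⁆)))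
      ≡⟨ ∑ₛ-∑adj-comm (λ T a b → F T * 𝟙 (does (T ≟ₛ ⁅ a ⁆ ∪ ⁅ b ⁆))) ⟩
    ∑adj (λ a b → ∑ₛ[ T ] (F T * 𝟙 (does (T ≟ₛ ⁅ a ⁆ ∪ ⁅ b ⁆))))
      ≡⟨ sum-cong-≗ (λ a → sum-cong-≗ λ b → cong (𝟙 (adj G a b) *_) (∑ₛ-δ (⁅ a ⁆ ∪ ⁅ b ⁆) F)) ⟩
    ∑adj (λ a b → F (⁅ a ⁆ ∪ ⁅ b ⁆)) ∎
    where open ≡-Reasoning
          reorder : ∀ e f → 2 * (e * f) ≡ f * (2 * e)
          reorder = solve-∀

  2*edgesIn : ∀ σ → 2 * edgesIn G σ ≡ ∑adj (λ a b → 𝟙 (lookup σ a) * 𝟙 (lookup σ b))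
  2*edgesIn σ = begin
    2 * length (filter P? (allSubsets n))
      ≡⟨ cong (2 *_) (trans (length-filter P? (allSubsets n)) (sum-map-allSubsets n (𝟙 ∘ does ∘ P?))) ⟩
    2 * ∑ₛ[ T ] 𝟙 (does (isEdge? G T) ∧ does (T ⊆? σ))
      ≡⟨ cong (2 *_) (∑ₛ-cong λ T → 𝟙-∧ (does (isEdge? G T)) _) ⟩
    2 * ∑ₛ[ T ] (𝟙 (does (isEdge? G T)) * 𝟙 (does (T ⊆? σ)))
      ≡⟨ 2*∑ₛ-isEdge (λ T → 𝟙 (does (T ⊆? σ))) ⟩
    ∑adj (λ a b → 𝟙 (does (⁅ a ⁆ ∪ ⁅ b ⁆ ⊆? σ)))
      ≡⟨ ∑adj-cong (λ {a} {b} _ → 𝟙[⁅a,b⁆⊆p] a b σ) ⟩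
    ∑adj (λ a b → 𝟙 (lookup σ a) * 𝟙 (lookup σ b)) ∎
    where open ≡-Reasoning
          P? = λ T → isEdge? G T ×-dec (T ⊆? σ)

  edgeBoundary : Subset n → ℕ
  edgeBoundary η = ∑adj (crossing η)

  deg≡edgeBoundary : ∀ j η → ∣ η ∣ ≡ j → deg G j η ≡ edgeBoundary η
  deg≡edgeBoundary j η ∣η∣≡j = *-cancelˡ-≡ (deg G j η) (edgeBoundary η) 2 (begin
    2 * length (filter P? (allSubsets n))
      ≡⟨ cong (2 *_) (trans (length-filter P? (allSubsets n)) (sum-map-allSubsets n (𝟙 ∘ does ∘ P?))) ⟩
    2 * ∑ₛ[ A ] 𝟙 (does (P? A))
      ≡⟨ cong (2 *_) (∑ₛ-cong split) ⟩
    2 * ∑ₛ[ A ] F (A △ η)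
      ≡⟨ cong (2 *_) (∑ₛ-△ η F) ⟩
    2 * ∑ₛ[ D ] (𝟙 (does (isEdge? G D)) * X (D △ η))
      ≡⟨ 2*∑ₛ-isEdge (λ D → X (D △ η)) ⟩
    ∑adj (λ a b → X ((⁅ a ⁆ ∪ ⁅ b ⁆) △ η))
      ≡⟨ ∑adj-cong (λ a~b → 𝟙[exchange] η (adj⇒≢ a~b) ∣η∣≡j) ⟩
    ∑adj (λ a b → crossing η a b + crossing η b a)
      ≡⟨ ∑adj-+ (crossing η) (λ a b → crossing η b a) ⟩
    edgeBoundary η + ∑adj (λ a b → crossing η b a)
      ≡⟨ cong (edgeBoundary η +_) (∑adj-flip (crossing η)) ⟩
    edgeBoundary η + edgeBoundary η
      ≡⟨ cong (edgeBoundary η +_) (sym (+-identityʳ (edgeBoundary η))) ⟩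
    2 * edgeBoundary η ∎)
    where
      open ≡-Reasoning
      P? = λ A → (∣ A ∣ ≟ j) ×-dec ((∣ A ∩ η ∣ ≟ j ∸ 1) ×-dec isEdge? G (A △ η))
      X : Subset n → ℕ
      X A = 𝟙 (does (∣ A ∣ ≟ j)) * 𝟙 (does (∣ A ∩ η ∣ ≟ j ∸ 1))
      F : Subset n → ℕ
      F D = 𝟙 (does (isEdge? G D)) * X (D △ η)
      split : ∀ A → 𝟙 (does (P? A)) ≡ F (A △ η)
      split A = begin
        𝟙 (does (∣ A ∣ ≟ j) ∧ (does (∣ A ∩ η ∣ ≟ j ∸ 1) ∧ does (isEdge? G (A △ η))))
          ≡⟨ trans (𝟙-∧ size? (meet? ∧ edge?)) (cong (𝟙 size? *_) (𝟙-∧ meet? edge?)) ⟩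
        𝟙 (does (∣ A ∣ ≟ j)) * (𝟙 (does (∣ A ∩ η ∣ ≟ j ∸ 1)) * 𝟙 (does (isEdge? G (A △ η))))
          ≡⟨ x*[y*z]≡z*[x*y] (𝟙 size?) (𝟙 meet?) (𝟙 edge?) ⟩
        𝟙 (does (isEdge? G (A △ η))) * X A
          ≡⟨ cong (λ B → 𝟙 (does (isEdge? G (A △ η))) * X B) (sym (△-involutive A η)) ⟩
        F (A △ η) ∎
        where size? = does (∣ A ∣ ≟ j)
              meet? = does (∣ A ∩ η ∣ ≟ j ∸ 1)
              edge? = does (isEdge? G (A △ η))

  ∑-edgeBoundary-∖ : ∀ σ → ∑[ u < n ] (𝟙 (lookup σ u) * edgeBoundary (σ ∖ u))
                       ≡ (∣ σ ∣ ∸ 1) * edgeBoundary σ + ∑adj (λ a b → 𝟙 (lookup σ a) * 𝟙 (lookup σ b))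
  ∑-edgeBoundary-∖ σ = begin
    ∑[ u < n ] (𝟙 (lookup σ u) * edgeBoundary (σ ∖ u))
      ≡⟨ sum-cong-≗ (λ u → ∑adj-*-distribˡ (𝟙 (lookup σ u)) (crossing (σ ∖ u))) ⟩
    ∑[ u < n ] ∑adj (λ a b → 𝟙 (lookup σ u) * crossing (σ ∖ u) a b)
      ≡⟨ ∑-∑adj-comm (λ u a b → 𝟙 (lookup σ u) * crossing (σ ∖ u) a b) ⟩
    ∑adj (λ a b → ∑[ u < n ] (𝟙 (lookup σ u) * crossing (σ ∖ u) a b))
      ≡⟨ ∑adj-cong (λ a~b → ∑-remove σ (adj⇒≢ a~b)) ⟩
    ∑adj (λ a b → (∣ σ ∣ ∸ 1) * crossing σ a b + internal a b)
      ≡⟨ ∑adj-+ (λ a b → (∣ σ ∣ ∸ 1) * crossing σ a b) internal ⟩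
    ∑adj (λ a b → (∣ σ ∣ ∸ 1) * crossing σ a b) + ∑adj internal
      ≡⟨ cong (_+ ∑adj internal) (sym (∑adj-*-distribˡ (∣ σ ∣ ∸ 1) (crossing σ))) ⟩
    (∣ σ ∣ ∸ 1) * edgeBoundary σ + ∑adj internal ∎
    where
      open ≡-Reasoning
      internal : Fin n → Fin n → ℕ
      internal a b = 𝟙 (lookup σ a) * 𝟙 (lookup σ b)

sumOver≡∑ : ∀ {n} (σ : Subset n) (f : Fin n → ℕ) → sumOver σ f ≡ ∑[ u < n ] (𝟙 (lookup σ u) * f u)
sumOver≡∑ {n} σ f = begin
  sum (map f (filter (_∈? σ) (allFin n)))
    ≡⟨ sum-map-filter (_∈? σ) f (allFin n) ⟩
  sum (map (λ u → 𝟙 (does (u ∈? σ)) * f u) (tabulate (λ u → u)))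
    ≡⟨ sum-map-tabulate (λ u → u) (λ u → 𝟙 (does (u ∈? σ)) * f u) ⟩
  ∑[ u < n ] (𝟙 (does (u ∈? σ)) * f u)
    ≡⟨ sum-cong-≗ (λ u → cong (λ e → 𝟙 e * f u) (lookup-∈? u σ)) ⟩
  ∑[ u < n ] (𝟙 (lookup σ u) * f u) ∎
  where open ≡-Reasoning

lemma3p2 : (n : ℕ) (G : Graph n) (k : ℕ) → 2 ≤ k → k ≤ n / 2 →
    (σ : Subset n) → ∣ σ ∣ ≡ k →
    sumOver σ (λ u → deg G (k ∸ 1) (σ ∖ u)) ≡ (k ∸ 1) * deg G k σ + 2 * edgesIn G σ
lemma3p2 n G _ _ _ σ refl = begin
  sumOver σ (λ u → deg G (∣ σ ∣ ∸ 1) (σ ∖ u))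
    ≡⟨ sumOver≡∑ σ _ ⟩
  ∑[ u < n ] (𝟙 (lookup σ u) * deg G (∣ σ ∣ ∸ 1) (σ ∖ u))
    ≡⟨ sum-cong-≗ removed-deg ⟩
  ∑[ u < n ] (𝟙 (lookup σ u) * edgeBoundary G (σ ∖ u))
    ≡⟨ ∑-edgeBoundary-∖ G σ ⟩
  (∣ σ ∣ ∸ 1) * edgeBoundary G σ + ∑adj G (λ a b → 𝟙 (lookup σ a) * 𝟙 (lookup σ b))
    ≡⟨ cong₂ _+_ (cong ((∣ σ ∣ ∸ 1) *_) (sym (deg≡edgeBoundary G ∣ σ ∣ σ refl))) (sym (2*edgesIn G σ)) ⟩
  (∣ σ ∣ ∸ 1) * deg G ∣ σ ∣ σ + 2 * edgesIn G σ ∎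
  where
    open ≡-Reasoning
    removed-deg : ∀ u → 𝟙 (lookup σ u) * deg G (∣ σ ∣ ∸ 1) (σ ∖ u) ≡ 𝟙 (lookup σ u) * edgeBoundary G (σ ∖ u)
    removed-deg u with lookup σ u in u∈σ
    ... | true  = cong (1 *_) (deg≡edgeBoundary G (∣ σ ∣ ∸ 1) (σ ∖ u) (∣p─⁅x⁆∣≡∣p∣∸1 σ u∈σ))
    ... | false = refl
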